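{- Let $\Gamma=R_n(a,r)$ be a non-trivially unstable Rose Window graph with $n=2m$, $1\le a,r\le m$, such that $\Gamma\times\mathbf{K}_2$ is not edge-transitive, and let $G=\mathrm{Aut}(\Gamma\times\mathbf{K}_2)$. Let $S_1=\{u_{i,j}: i\equiv j\pmod2\}$, $S_2=\{u_{i,j}: i\not\equiv j\pmod 2\}$. Suppose there is an unexpected automorphism $\sigma$ of $\Gamma\times\mathbf{K}_2$ with $\sigma(S_1\cup S_2)\ne S_1\cup S_2$. Let $K$ be the subgroup of $G$ consisting of the automorphisms that map each of $S_1$, $S_2$, and the vertex set of each connected component of the hub subgraph onto itself. If some non-identity element of $K$ fixes every vertex of $S_1$, then $\Gamma$ is isomorphic to a graph in one of the families W1, W5, W6.
   Context: $R_n(a,r)$ ($n\ge3$, $a,r\in\mathbb{Z}_n$ nonzero) has vertices $u_i,v_i$ ($i\in\mathbb{Z}_n$) and edges $\{u_i,u_{i+1}\},\{v_i,v_{i+r}\},\{u_i,v_i\},\{u_{i+a},v_i\}$. The canonical double cover $\Gamma\times\mathbf{K}_2$ has vertices $u_{i,j}$, $v_{i,j}$ ($i\in\mathbb{Z}_n$, $j\in\mathbb{Z}_2$) and edges $\{u_{i,j},u_{i+1,j+1}\}$, $\{v_{i,j},v_{i+r,j+1}\}$, $\{u_{i,j},v_{i,j+1}\}$, $\{u_{i+a,j},v_{i,j+1}\}$. The hub subgraph is the subgraph with vertex set $\{v_{i,j}\}$ and edges $\{v_{i,j},v_{i+r,j+1}\}$. $\Gamma$ is stable if $\mathrm{Aut}(\Gamma\times\mathbf{K}_2)\cong\mathrm{Aut}(\Gamma)\times\mathbb{Z}_2$,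 unstable otherwise; non-trivially unstable means unstable, connected, non-bipartite, and no two distinct vertices have the same neighborhood. Expected automorphisms are the elements of the group generated by $(x,j)\mapsto(x,1-j)$ and $(x,j)\mapsto(\alpha(x),j)$, $\alpha\in\mathrm{Aut}(\Gamma)$; others are unexpected. Families: W1 consists of $R_{4k}(2k,R)$; W5 of $R_{8k}(A,2k)$ with $A$ even; W6 of $R_{4k}(k,R)$ with $k,R$ odd, $k\ge3$. -}

module Defs where

open import Data.Nat using (ℕ; zero; suc; _+_; _*_; _≤_; _%_)
open import Data.Nat.Divisibility using (_∣_)
open import Data.Fin using (Fin; toℕ)
open import Data.Bool using (Bool; true; false; not)
open import Data.Product using (Σ; ∃; _×_; _,_)
open import Data.Sum using (_⊎_)
open import Data.Empty using (⊥)
open import Data.Unit using (⊤)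
open import Relation.Nullary using (¬_)
open import Relation.Binary.PropositionalEquality using (_≡_; _≢_)
open import Function.Bundles using (_↔_; _⇔_; Inverse)

record Graph : Set₁ where
  field
    V   : Set
    Adj : V → V → Set
open Graph public

record Iso (G H : Graph) : Set where
  field
    bij : V G ↔ V H
    pres : ∀ x y → Adj G x y ⇔ Adj H (Inverse.to bij x) (Inverse.to bij y)

Aut : Graph → Set
Aut G = Iso G G

app : ∀ {G H} → Iso G H → V G → V H
app f = Inverse.to (Iso.bij f)

data Star {A : Set} (R : A → A → Set) : A → A → Set where
  ε   : ∀ {x} → Star R x x
  _◅_ : ∀ {x y z} → R x y → Star R y z → Star R x z

Connected : Graph → Set
Connected G = ∀ x y → Star (Adj G) x y

Bipartite : Graph → Set
Bipartite G = Σ (V G → Bool) λ c → ∀ x y → Adj G x y → c x ≢ c y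

TwinFree : Graph → Set
TwinFree G = ∀ x y → (∀ z → Adj G x z ⇔ Adj G y z) → x ≡ y

MapsOnto : {A : Set} → (A → A) → (A → Set) → Set
MapsOnto {A} f P = ∀ y → P y ⇔ (Σ A λ x → P x × f x ≡ y)

EdgeTransitive : Graph → Set
EdgeTransitive G = ∀ x y x' y' → Adj G x y → Adj G x' y' →
  Σ (Aut G) λ f → (app f x ≡ x' × app f y ≡ y') ⊎ (app f x ≡ y' × app f y ≡ x')

-- Canonical double cover Γ × K₂ (second coordinate in ℤ₂ ≅ Bool)

DC : Graph → Graph
DC G = record
  { V   = V G × Bool
  ; Adj = λ { (x , j) (y , k) → Adj G x y × k ≡ not j } }

-- expected automorphisms: elements of the group generated by the swap
-- (x,j) ↦ (x,1-j) and the lifts (x,j) ↦ (α x, j), α ∈ Aut Γ.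
-- (The generators commute, so the group consists exactly of the maps below.)
Expected : (G : Graph) → Aut (DC G) → Set
Expected G f = Σ (Aut G) λ α →
    (∀ x j → app f (x , j) ≡ (app α x , j))
  ⊎ (∀ x j → app f (x , j) ≡ (app α x , not j))

Unexpected : (G : Graph) → Aut (DC G) → Set
Unexpected G f = ¬ Expected G f

-- Unstable: Aut(Γ×K₂) is not (isomorphic to) Aut(Γ)×ℤ₂.  For finite graphs the
-- expected automorphisms form a subgroup ≅ Aut(Γ)×ℤ₂, so this is equivalent to the
-- existence of an unexpected automorphism.
Unstable : Graph → Set
Unstable G = Σ (Aut (DC G)) λ f → Unexpected G f

NontriviallyUnstable : Graph → Set
NontriviallyUnstable G = Unstable G × Connected G × ¬ Bipartite G × TwinFree G

-- Rose window graphs R_n(a,r); elements of ℤ_n are represented by Fin n,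
-- the parameters a, r by natural numbers (read modulo n).

_≡_[mod_] : ℕ → ℕ → ℕ → Set
x ≡ y [mod n ] = Σ ℕ λ q → (x ≡ y + q * n) ⊎ (y ≡ x + q * n)

data RVtx (n : ℕ) : Set where
  u : Fin n → RVtx n
  v : Fin n → RVtx n

REdge : (n a r : ℕ) → RVtx n → RVtx n → Set
REdge n a r (u i) (u j) = toℕ j ≡ toℕ i + 1 [mod n ]
REdge n a r (v i) (v j) = toℕ j ≡ toℕ i + r [mod n ]
REdge n a r (u i) (v j) = (toℕ i ≡ toℕ j [mod n ]) ⊎ (toℕ i ≡ toℕ j + a [mod n ])
REdge n a r (v i) (u j) = ⊥

RoseWindow : (n a r : ℕ) → Graph
RoseWindow n a r = record
  { V   = RVtx n
  ; Adj = λ x y → REdge n a r x y ⊎ REdge n a r y x }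

ValidRW : ℕ → ℕ → ℕ → Set
ValidRW n a r = 3 ≤ n × ¬ (n ∣ a) × ¬ (n ∣ r)

bit : Bool → ℕ
bit false = 0
bit true  = 1

S₁ : (n : ℕ) → RVtx n × Bool → Set
S₁ n (u i , j) = toℕ i % 2 ≡ bit j
S₁ n (v i , j) = ⊥

S₂ : (n : ℕ) → RVtx n × Bool → Set
S₂ n (u i , j) = toℕ i % 2 ≢ bit j
S₂ n (v i , j) = ⊥

S₁∪S₂ : (n : ℕ) → RVtx n × Bool → Set
S₁∪S₂ n x = S₁ n x ⊎ S₂ n x

IsHubVertex : (n : ℕ) → RVtx n × Bool → Set
IsHubVertex n (u i , j) = ⊥
IsHubVertex n (v i , j) = ⊤

HubAdj : (n a r : ℕ) → RVtx n × Bool → RVtx n × Bool → Set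
HubAdj n a r (v i , j) (v i' , j') = Adj (DC (RoseWindow n a r)) (v i , j) (v i' , j')
HubAdj n a r _ _ = ⊥

HubComponent : (n a r : ℕ) → RVtx n × Bool → RVtx n × Bool → Set
HubComponent n a r w x = Star (HubAdj n a r) w x

InK : (n a r : ℕ) → Aut (DC (RoseWindow n a r)) → Set
InK n a r g =
  MapsOnto (app g) (S₁ n) × MapsOnto (app g) (S₂ n) ×
  (∀ w → IsHubVertex n w → MapsOnto (app g) (HubComponent n a r w))

InW1 : Graph → Set
InW1 Γ = Σ ℕ λ k → Σ ℕ λ R →
  ValidRW (4 * k) (2 * k) R × Iso Γ (RoseWindow (4 * k) (2 * k) R)

InW5 : Graph → Set
InW5 Γ = Σ ℕ λ k → Σ ℕ λ A →
  ValidRW (8 * k) A (2 * k) × A % 2 ≡ 0 × Iso Γ (RoseWindow (8 * k) A (2 * k))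

InW6 : Graph → Set
InW6 Γ = Σ ℕ λ k → Σ ℕ λ R →
  ValidRW (4 * k) k R × k % 2 ≡ 1 × R % 2 ≡ 1 × 3 ≤ k ×
  Iso Γ (RoseWindow (4 * k) k R)

{-# OPTIONS --safe #-}
module Submission where

-- We show that g is the identity unless a = m with m even (W1) or a, r are even with
-- 2r = m (W5).  The image of a vertex under g is
-- adjacent to every fixed neighbour of the vertex, and two fixed neighbours that are a
-- step d apart pin the vertex down unless 2d ≡ 0, i.e. d = m (mod 2m).  Moreover g
-- maps each hub component onto itself, so it preserves the ℤ₂-valued invariant
-- parity(k) + l·parity(r) of v_{k,l}.
--   * a odd: one spoke neighbour of v_{k,l} lies in S₁ and, with the invariant, fixes it.
--   * a even: r is even since Γ is not bipartite.  If parity(k) ≠ l both spoke neighbours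
--     of v_{k,l} lie in S₁, which fixes it unless a = m; if parity(k) = l both rim
--     neighbours are of the former kind, which fixes it unless 2r = m.
--   * Both spoke neighbours of u_{i,j} ∈ S₂ are hub vertices, hence fixed; this fixes
--     u_{i,j} unless a = m, and then a must be even because g preserves S₂.

open import Data.Bool using (Bool; true; false; not)
open import Data.Bool.Properties using (not-involutive; not-injective)
open import Data.Empty using (⊥-elim)
open import Data.Fin using (Fin; toℕ)
open import Data.Fin.Properties using (toℕ-injective; toℕ<n; toℕ-fromℕ<)
open import Data.Nat using (ℕ; suc; _+_; _*_; _∸_; _≤_; _<_; _%_; _/_; parity; NonZero; >-nonZero; z≤n; _≟_)
open import Data.Nat.DivMod
  using (_mod_; m≡m%n+[m/n]*n; [m+kn]%n≡m%n; [m+n]%n≡m%n; %-distribˡ-+; m%n%n≡m%n; m<n⇒m%n≡m; m%n<n)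
open import Data.Nat.Divisibility using (_∣_; divides; m%n≡0⇒n∣m; >⇒∤)
open import Data.Nat.Properties
  using (≤-total; ≤-trans; ≤-<-trans; m≤n⇒m<n∨m≡n; n≤1+n; <⇒≱; m≤m+n; m<m+n; m+[n∸m]≡n; m∸n+n≡m;
         +-assoc; +-comm; +-identityʳ; +-cancelˡ-≡; +-mono-<; +-mono-≤; +-monoʳ-≤; m+n≡0⇒m≡0;
         *-assoc; *-comm; *-identityˡ; *-distribʳ-+; *-cancelˡ-≡; *-monoʳ-≤; m*n≢0)
open import Data.Nat.Tactic.RingSolver using (solve-∀)
open import Data.Parity.Base as ℙ using (Parity; 0ℙ; 1ℙ; _⁻¹)
open import Data.Parity.Properties as ℙₚ using (p≢p⁻¹; ⁻¹-involutive; +-homo-+; *-homo-*)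
open import Data.Product using (Σ; _×_; _,_; proj₁; proj₂)
open import Data.Sum as Sum using (_⊎_; inj₁; inj₂; [_,_]; swap)
open import Data.Unit using (tt)
open import Function using (_∘_)
open import Function.Bundles using (_⇔_; mk⇔; Equivalence)
open import Function.Construct.Identity using (↔-id; ⇔-id)
open import Relation.Binary.PropositionalEquality
  using (_≡_; _≢_; refl; sym; trans; cong; cong₂; subst; module ≡-Reasoning)
open import Relation.Nullary using (¬_; yes; no)
open import Relation.Nullary.Decidable using (_×-dec_)

open import Defs

open ≡-Reasoning

variable
  x y z d x₁ x₂ : ℕ

⟦_⟧ : Bool → Parity
⟦ false ⟧ = 0ℙ
⟦ true  ⟧ = 1ℙ

⟦not⟧ : ∀ b → ⟦ not b ⟧ ≡ ⟦ b ⟧ ⁻¹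
⟦not⟧ false = refl
⟦not⟧ true  = refl

parity-dichotomy : ∀ p q → p ≡ q ⊎ p ≡ q ⁻¹
parity-dichotomy 0ℙ 0ℙ = inj₁ refl
parity-dichotomy 0ℙ 1ℙ = inj₂ refl
parity-dichotomy 1ℙ 0ℙ = inj₂ refl
parity-dichotomy 1ℙ 1ℙ = inj₁ refl

%2≡bit⇔parity≡⟦⟧ : ∀ x j → x % 2 ≡ bit j ⇔ parity x ≡ ⟦ j ⟧
%2≡bit⇔parity≡⟦⟧ 0 false = mk⇔ (λ _ → refl) (λ _ → refl)
%2≡bit⇔parity≡⟦⟧ 0 true  = mk⇔ (λ ()) (λ ())
%2≡bit⇔parity≡⟦⟧ 1 false = mk⇔ (λ ()) (λ ())
%2≡bit⇔parity≡⟦⟧ 1 true  = mk⇔ (λ _ → refl) (λ _ → refl)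
%2≡bit⇔parity≡⟦⟧ (suc (suc x)) j = %2≡bit⇔parity≡⟦⟧ x j

even⇒double : ∀ x → parity x ≡ 0ℙ → Σ ℕ λ k → x ≡ 2 * k
even⇒double x x-even with m%n≡0⇒n∣m x 2 (Equivalence.from (%2≡bit⇔parity≡⟦⟧ x false) x-even)
... | divides k x≡k*2 = k , trans x≡k*2 (*-comm k 2)

module Modular (n : ℕ) .{{_ : NonZero n}} where

  infix 4 _≈_
  _≈_ : ℕ → ℕ → Set
  x ≈ y = x % n ≡ y % n

  ≡⇒≈ : x ≡ y → x ≈ y
  ≡⇒≈ = cong (_% n)

  ≡[mod]⇒≈ : x ≡ y [mod n ] → x ≈ y
  ≡[mod]⇒≈ {x} {y} (q , inj₁ x≡y+qn) = trans (≡⇒≈ x≡y+qn) ([m+kn]%n≡m%n y q n)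
  ≡[mod]⇒≈ {x} {y} (q , inj₂ y≡x+qn) = sym (trans (≡⇒≈ y≡x+qn) ([m+kn]%n≡m%n x q n))

  private
    ≈⇒≡+quotient : x ≈ y → x / n ≤ y / n → y ≡ x + (y / n ∸ x / n) * n
    ≈⇒≡+quotient {x} {y} x≈y x/n≤y/n = begin
      y                                 ≡⟨ m≡m%n+[m/n]*n y n ⟩
      y % n + y / n * n                 ≡⟨ cong₂ (λ s t → s + t * n) (sym x≈y) (sym (m+[n∸m]≡n x/n≤y/n)) ⟩
      x % n + (x / n + q) * n           ≡⟨ cong (x % n +_) (*-distribʳ-+ n (x / n) q) ⟩
      x % n + (x / n * n + q * n)       ≡⟨ sym (+-assoc (x % n) _ _) ⟩
      x % n + x / n * n + q * n         ≡⟨ cong (_+ q * n) (sym (m≡m%n+[m/n]*n x n)) ⟩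
      x + q * n                         ∎
      where q = y / n ∸ x / n

  ≈⇒≡[mod] : x ≈ y → x ≡ y [mod n ]
  ≈⇒≡[mod] {x} {y} x≈y with ≤-total (x / n) (y / n)
  ... | inj₁ x/n≤y/n = y / n ∸ x / n , inj₂ (≈⇒≡+quotient x≈y x/n≤y/n)
  ... | inj₂ y/n≤x/n = x / n ∸ y / n , inj₁ (≈⇒≡+quotient (sym x≈y) y/n≤x/n)

  +-congʳ-≈ : ∀ z → x ≈ y → x + z ≈ y + z
  +-congʳ-≈ {x} {y} z x≈y = begin
    (x + z) % n             ≡⟨ %-distribˡ-+ x z n ⟩
    (x % n + z % n) % n     ≡⟨ cong (λ t → (t + z % n) % n) x≈y ⟩
    (y % n + z % n) % n     ≡⟨ %-distribˡ-+ y z n ⟨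
    (y + z) % n             ∎

  +-cancelˡ-≈ : ∀ z → z + x ≈ z + y → x ≈ y
  +-cancelˡ-≈ {x} {y} z eq with ≈⇒≡[mod] eq
  ... | q , inj₁ e = ≡[mod]⇒≈ (q , inj₁ (+-cancelˡ-≡ z _ _ (trans e (+-assoc z y _))))
  ... | q , inj₂ e = ≡[mod]⇒≈ (q , inj₂ (+-cancelˡ-≡ z _ _ (trans e (+-assoc z x _))))

  +-cancelʳ-≈ : ∀ z → x + z ≈ y + z → x ≈ y
  +-cancelʳ-≈ {x} {y} z eq = +-cancelˡ-≈ z (trans (≡⇒≈ (+-comm z x)) (trans eq (≡⇒≈ (+-comm y z))))

  double≈0 : d < n → d + d ≈ 0 → d ≡ 0 ⊎ d + d ≡ n
  double≈0 {d} d<n 2d≈0 with m%n≡0⇒n∣m (d + d) n (trans 2d≈0 (m<n⇒m%n≡m (≤-<-trans z≤n d<n)))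
  ... | divides 0 2d≡0 = inj₁ (m+n≡0⇒m≡0 d 2d≡0)
  ... | divides 1 2d≡n = inj₂ (trans 2d≡n (+-identityʳ n))
  ... | divides (suc (suc q)) 2d≡[2+q]n =
    ⊥-elim (<⇒≱ (+-mono-< d<n d<n) (subst (n + n ≤_) (sym 2d≡[2+q]n) (+-monoʳ-≤ n (m≤m+n n (q * n)))))

  round-trip : y ≈ x + d → x ≈ y + d → d + d ≈ 0
  round-trip {y} {x} {d} y≈x+d x≈y+d = +-cancelˡ-≈ x (begin
    (x + (d + d)) % n     ≡⟨ ≡⇒≈ (+-assoc x d d) ⟨
    (x + d + d) % n       ≡⟨ +-congʳ-≈ d y≈x+d ⟨
    (y + d) % n           ≡⟨ x≈y+d ⟨
    x % n                 ≡⟨ ≡⇒≈ (+-identityʳ x) ⟨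
    (x + 0) % n           ∎)

  antipodal : d ≤ n → d + d ≢ n → y ≈ x + d → x ≈ y + d → x ≈ y
  antipodal {d} {y} {x} d≤n 2d≢n y≈x+d x≈y+d with m≤n⇒m<n∨m≡n d≤n
  ... | inj₂ refl = trans x≈y+d ([m+n]%n≡m%n y n)
  ... | inj₁ d<n with double≈0 d<n (round-trip y≈x+d x≈y+d)
  ...   | inj₁ refl = trans x≈y+d (≡⇒≈ (+-identityʳ y))
  ...   | inj₂ 2d≡n = ⊥-elim (2d≢n 2d≡n)

  toℕ-mod : ∀ x → toℕ (x mod n) ≈ x
  toℕ-mod x = trans (≡⇒≈ (toℕ-fromℕ< (m%n<n x n))) (m%n%n≡m%n x n)

  ≈⇒≡ : {i j : Fin n} → toℕ i ≈ toℕ j → i ≡ j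
  ≈⇒≡ {i} {j} i≈j = toℕ-injective (trans (sym (m<n⇒m%n≡m (toℕ<n i))) (trans i≈j (m<n⇒m%n≡m (toℕ<n j))))

  _⊕_ : Fin n → ℕ → Fin n
  i ⊕ c = (toℕ i + c) mod n

  _⊖_ : Fin n → ℕ → Fin n
  i ⊖ c = (toℕ i + (n ∸ c)) mod n

  ⊖-+ : ∀ {c} (i : Fin n) → c ≤ n → toℕ (i ⊖ c) + c ≈ toℕ i
  ⊖-+ {c} i c≤n = trans (+-congʳ-≈ c (toℕ-mod _))
    (trans (≡⇒≈ (trans (+-assoc (toℕ i) _ c) (cong (toℕ i +_) (m∸n+n≡m c≤n)))) ([m+n]%n≡m%n (toℕ i) n))

  module EvenModulus (n-even : parity n ≡ 0ℙ) where

    ≈-parity : x ≈ y → parity x ≡ parity y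
    ≈-parity {x} {y} x≈y = trans (parity-% x) (trans (cong parity x≈y) (sym (parity-% y)))
      where
      parity-% : ∀ x → parity x ≡ parity (x % n)
      parity-% x = begin
        parity x                                          ≡⟨ cong parity (m≡m%n+[m/n]*n x n) ⟩
        parity (x % n + x / n * n)                        ≡⟨ +-homo-+ (x % n) _ ⟩
        parity (x % n) ℙ.+ parity (x / n * n)             ≡⟨ cong (parity (x % n) ℙ.+_) (*-homo-* (x / n) n) ⟩
        parity (x % n) ℙ.+ (parity (x / n) ℙ.* parity n)  ≡⟨ cong (λ p → parity (x % n) ℙ.+ (parity (x / n) ℙ.* p)) n-even ⟩
        parity (x % n) ℙ.+ (parity (x / n) ℙ.* 0ℙ)        ≡⟨ cong (parity (x % n) ℙ.+_) (ℙₚ.*-zeroʳ (parity (x / n))) ⟩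
        parity (x % n) ℙ.+ 0ℙ                             ≡⟨ ℙₚ.+-identityʳ _ ⟩
        parity (x % n)                                    ∎

    parity-+even : ∀ x d → parity d ≡ 0ℙ → y ≈ x + d → parity y ≡ parity x
    parity-+even {y} x d d-even y≈x+d = begin
      parity y              ≡⟨ ≈-parity y≈x+d ⟩
      parity (x + d)        ≡⟨ +-homo-+ x d ⟩
      parity x ℙ.+ parity d ≡⟨ cong (parity x ℙ.+_) d-even ⟩
      parity x ℙ.+ 0ℙ       ≡⟨ ℙₚ.+-identityʳ (parity x) ⟩
      parity x              ∎

    parity-+odd : ∀ x d → parity d ≡ 1ℙ → y ≈ x + d → parity y ≡ parity x ⁻¹
    parity-+odd {y} x d d-odd y≈x+d = begin
      parity y              ≡⟨ ≈-parity y≈x+d ⟩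
      parity (x + d)        ≡⟨ +-homo-+ x d ⟩
      parity x ℙ.+ parity d ≡⟨ cong (parity x ℙ.+_) d-odd ⟩
      parity x ℙ.+ 1ℙ       ≡⟨ ℙₚ.+-comm (parity x) 1ℙ ⟩
      parity x ⁻¹           ∎

module RoseWindowRigidity (m a r : ℕ) .{{_ : NonZero m}} (a≤m : a ≤ m) (r≤m : r ≤ m) where

  n : ℕ
  n = 2 * m

  instance
    n≢0 : NonZero n
    n≢0 = m*n≢0 2 m

  open Modular n

  Γ : Graph
  Γ = RoseWindow n a r

  n-even : parity n ≡ 0ℙ
  n-even = *-homo-* 2 m

  open EvenModulus n-even

  a≤n : a ≤ n
  a≤n = ≤-trans a≤m (m≤m+n m _)

  r≤n : r ≤ n
  r≤n = ≤-trans r≤m (m≤m+n m _)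

  r+r≤n : r + r ≤ n
  r+r≤n = +-mono-≤ r≤m (subst (r ≤_) (sym (+-identityʳ m)) r≤m)

  double≢n : d ≢ m → d + d ≢ n
  double≢n {d} d≢m 2d≡n = d≢m (*-cancelˡ-≡ d m 2 (trans (cong (d +_) (+-identityʳ d)) 2d≡n))

  Spoke : ℕ → ℕ → Set
  Spoke x y = x ≈ y ⊎ x ≈ y + a

  Rim : ℕ → ℕ → Set
  Rim x y = y ≈ x + r ⊎ x ≈ y + r

  spoke⇒adj : {i k : Fin n} → Spoke (toℕ i) (toℕ k) → Adj Γ (u i) (v k)
  spoke⇒adj = inj₁ ∘ Sum.map ≈⇒≡[mod] ≈⇒≡[mod]

  adj⇒spoke : {i k : Fin n} → Adj Γ (u i) (v k) → Spoke (toℕ i) (toℕ k)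
  adj⇒spoke (inj₁ e) = Sum.map ≡[mod]⇒≈ ≡[mod]⇒≈ e

  rim⇒adj : {k k' : Fin n} → Rim (toℕ k) (toℕ k') → Adj Γ (v k) (v k')
  rim⇒adj = Sum.map ≈⇒≡[mod] ≈⇒≡[mod]

  adj⇒rim : {k k' : Fin n} → Adj Γ (v k) (v k') → Rim (toℕ k) (toℕ k')
  adj⇒rim = Sum.map ≡[mod]⇒≈ ≡[mod]⇒≈

  rim-succ : ∀ k → Rim (toℕ k) (toℕ (k ⊕ r))
  rim-succ k = inj₁ (toℕ-mod _)

  rim-pred : ∀ k → Rim (toℕ k) (toℕ (k ⊖ r))
  rim-pred k = inj₂ (sym (⊖-+ k r≤n))

  odd-spokes : ∀ {x} y z → parity a ≡ 1ℙ → Spoke x y → Spoke x z → parity y ≡ parity z → y ≈ z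
  odd-spokes y z a-odd (inj₁ x≈y) (inj₁ x≈z) _ = trans (sym x≈y) x≈z
  odd-spokes y z a-odd (inj₂ x≈y+a) (inj₂ x≈z+a) _ = +-cancelʳ-≈ a (trans (sym x≈y+a) x≈z+a)
  odd-spokes y z a-odd (inj₁ x≈y) (inj₂ x≈z+a) py≡pz =
    ⊥-elim (p≢p⁻¹ _ (trans (sym py≡pz) (parity-+odd z a a-odd (trans (sym x≈y) x≈z+a))))
  odd-spokes y z a-odd (inj₂ x≈y+a) (inj₁ x≈z) py≡pz =
    ⊥-elim (p≢p⁻¹ _ (trans py≡pz (parity-+odd y a a-odd (trans (sym x≈z) x≈y+a))))

  two-spokes : a ≢ m → Spoke x y → Spoke z y → z ≈ x + a → x ≈ y
  two-spokes a≢m (inj₁ x≈y) _ _ = x≈y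
  two-spokes a≢m (inj₂ x≈y+a) (inj₁ z≈y) z≈x+a = antipodal a≤n (double≢n a≢m) (trans (sym z≈y) z≈x+a) x≈y+a
  two-spokes a≢m (inj₂ _) (inj₂ z≈y+a) z≈x+a = +-cancelʳ-≈ a (trans (sym z≈x+a) z≈y+a)

  two-rims : r + r ≢ m → Rim y x₁ → Rim y x₂ → x₁ ≈ x + r → x ≈ x₂ + r → y ≈ x
  two-rims _ (inj₁ x₁≈y+r) _ x₁≈x+r _ = +-cancelʳ-≈ r (trans (sym x₁≈y+r) x₁≈x+r)
  two-rims _ _ (inj₂ y≈x₂+r) _ x≈x₂+r = trans y≈x₂+r (sym x≈x₂+r)
  two-rims {y} {x₁} {x₂} {x} 2r≢m (inj₂ y≈x₁+r) (inj₁ x₂≈y+r) x₁≈x+r x≈x₂+r =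
    antipodal r+r≤n (double≢n 2r≢m) x≈y+2r y≈x+2r
    where
    y≈x+2r : y ≈ x + (r + r)
    y≈x+2r = trans y≈x₁+r (trans (+-congʳ-≈ r x₁≈x+r) (≡⇒≈ (+-assoc x r r)))
    x≈y+2r : x ≈ y + (r + r)
    x≈y+2r = trans x≈x₂+r (trans (+-congʳ-≈ r x₂≈y+r) (≡⇒≈ (+-assoc y r r)))

  hub-invariant : Fin n → Bool → Parity
  hub-invariant k l = parity (toℕ k) ℙ.+ (⟦ l ⟧ ℙ.* parity r)

  private
    rim-identity : ∀ p q l → (p ℙ.+ q) ℙ.+ (⟦ not l ⟧ ℙ.* q) ≡ p ℙ.+ (⟦ l ⟧ ℙ.* q)
    rim-identity 0ℙ 0ℙ false = refl
    rim-identity 0ℙ 0ℙ true  = refl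
    rim-identity 0ℙ 1ℙ false = refl
    rim-identity 0ℙ 1ℙ true  = refl
    rim-identity 1ℙ 0ℙ false = refl
    rim-identity 1ℙ 0ℙ true  = refl
    rim-identity 1ℙ 1ℙ false = refl
    rim-identity 1ℙ 1ℙ true  = refl

  hub-invariant-step : ∀ {k k'} l → toℕ k' ≈ toℕ k + r → hub-invariant k l ≡ hub-invariant k' (not l)
  hub-invariant-step {k} {k'} l k'≈k+r = sym (begin
    parity (toℕ k') ℙ.+ (⟦ not l ⟧ ℙ.* parity r)                   ≡⟨ cong (ℙ._+ (⟦ not l ⟧ ℙ.* parity r)) (≈-parity k'≈k+r) ⟩
    parity (toℕ k + r) ℙ.+ (⟦ not l ⟧ ℙ.* parity r)                ≡⟨ cong (ℙ._+ (⟦ not l ⟧ ℙ.* parity r)) (+-homo-+ (toℕ k) r) ⟩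
    (parity (toℕ k) ℙ.+ parity r) ℙ.+ (⟦ not l ⟧ ℙ.* parity r)     ≡⟨ rim-identity (parity (toℕ k)) (parity r) l ⟩
    parity (toℕ k) ℙ.+ (⟦ l ⟧ ℙ.* parity r)                        ∎)

  hub-invariant-adj : ∀ {k l k' l'} → HubAdj n a r (v k , l) (v k' , l') → hub-invariant k l ≡ hub-invariant k' l'
  hub-invariant-adj {k} {l} {k'} (adj , refl) with adj⇒rim adj
  ... | inj₁ k'≈k+r = hub-invariant-step l k'≈k+r
  ... | inj₂ k≈k'+r = trans (cong (hub-invariant k) (sym (not-involutive l))) (sym (hub-invariant-step (not l) k≈k'+r))

  hub-component : ∀ {k l w} → HubComponent n a r (v k , l) w →
    Σ (Fin n) λ k' → Σ Bool λ l' → w ≡ (v k' , l') × hub-invariant k l ≡ hub-invariant k' l'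
  hub-component ε = _ , _ , refl , refl
  hub-component (_◅_ {y = v _ , _} adj path) with hub-component path
  ... | k' , l' , refl , inv = k' , l' , refl , trans (hub-invariant-adj adj) inv

  colour : RVtx n → Parity
  colour (u i) = parity (toℕ i)
  colour (v k) = parity (toℕ k) ⁻¹

  bipartite : parity a ≡ 0ℙ → parity r ≡ 1ℙ → Bipartite Γ
  bipartite a-even r-odd = toBool ∘ colour , λ x y →
    [ (λ e → properly-coloured x y e ∘ toBool-injective) , (λ e → properly-coloured y x e ∘ toBool-injective ∘ sym) ]
    where
    toBool : Parity → Bool
    toBool 0ℙ = false
    toBool 1ℙ = true

    toBool-injective : ∀ {p q} → toBool p ≡ toBool q → p ≡ q
    toBool-injective {0ℙ} {0ℙ} _ = refl
    toBool-injective {1ℙ} {1ℙ} _ = refl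

    properly-coloured : ∀ x y → REdge n a r x y → colour x ≢ colour y
    properly-coloured (u i) (u j) e pi≡pj =
      p≢p⁻¹ _ (trans pi≡pj (parity-+odd (toℕ i) 1 refl (≡[mod]⇒≈ e)))
    properly-coloured (v i) (v j) e pi⁻¹≡pj⁻¹ =
      p≢p⁻¹ _ (trans (ℙₚ.⁻¹-injective pi⁻¹≡pj⁻¹) (parity-+odd (toℕ i) r r-odd (≡[mod]⇒≈ e)))
    properly-coloured (u i) (v j) (inj₁ e) pi≡pj⁻¹ =
      p≢p⁻¹ _ (trans (sym (≈-parity (≡[mod]⇒≈ e))) pi≡pj⁻¹)
    properly-coloured (u i) (v j) (inj₂ e) pi≡pj⁻¹ =
      p≢p⁻¹ _ (trans (sym (parity-+even (toℕ j) a a-even (≡[mod]⇒≈ e))) pi≡pj⁻¹)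

  W1-shape : Set
  W1-shape = a ≡ m × parity m ≡ 0ℙ

  W5-shape : Set
  W5-shape = parity a ≡ 0ℙ × parity r ≡ 0ℙ × r + r ≡ m

  module _ (g : Aut (DC Γ)) (g∈K : InK n a r g) (g-fixes-S₁ : ∀ x → S₁ n x → app g x ≡ x) where

    G : RVtx n × Bool → RVtx n × Bool
    G = app g

    Fixed : RVtx n × Bool → Set
    Fixed x = G x ≡ x

    image-adj-fixed : ∀ {x y x'} → Fixed y → Adj (DC Γ) x y → G x ≡ x' → Adj (DC Γ) x' y
    image-adj-fixed {x} {y} fix adj refl = subst (Adj (DC Γ) (G x)) fix (Equivalence.to (Iso.pres g x y) adj)

    hub-image : ∀ k l → Σ (Fin n) λ k' → Σ Bool λ l' →
      G (v k , l) ≡ (v k' , l') × hub-invariant k l ≡ hub-invariant k' l'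
    hub-image k l = hub-component (Equivalence.from (proj₂ (proj₂ g∈K) (v k , l) tt (G (v k , l))) ((v k , l) , ε , refl))

    S₂-image : ∀ {i j} → S₂ n (u i , j) → Σ (Fin n) λ i' → Σ Bool λ j' → G (u i , j) ≡ (u i' , j') × S₂ n (u i' , j')
    S₂-image {i} {j} s = S₂-vertex (G (u i , j)) (Equivalence.from (proj₁ (proj₂ g∈K) (G (u i , j))) ((u i , j) , s , refl))
      where
      S₂-vertex : ∀ w → S₂ n w → Σ (Fin n) λ i' → Σ Bool λ j' → w ≡ (u i' , j') × S₂ n (u i' , j')
      S₂-vertex (u i' , j') s' = i' , j' , refl , s'

    S₁-fixed : ∀ {i j} → parity (toℕ i) ≡ ⟦ j ⟧ → Fixed (u i , j)
    S₁-fixed {i} {j} p = g-fixes-S₁ _ (Equivalence.from (%2≡bit⇔parity≡⟦⟧ (toℕ i) j) p)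

    S₂-parity : ∀ {i j} → S₂ n (u i , j) → parity (toℕ i) ≡ ⟦ j ⟧ ⁻¹
    S₂-parity {i} {j} s with parity-dichotomy (parity (toℕ i)) ⟦ j ⟧
    ... | inj₁ p = ⊥-elim (s (Equivalence.from (%2≡bit⇔parity≡⟦⟧ (toℕ i) j) p))
    ... | inj₂ p = p

    v-fixed : ∀ {k l k' l'} → G (v k , l) ≡ (v k' , l') → toℕ k' ≈ toℕ k → l' ≡ l → Fixed (v k , l)
    v-fixed Gx≡ k'≈k refl = trans Gx≡ (cong (λ k → v k , _) (≈⇒≡ k'≈k))

    u-fixed : ∀ {i j i' j'} → G (u i , j) ≡ (u i' , j') → toℕ i' ≈ toℕ i → j' ≡ j → Fixed (u i , j)
    u-fixed Gx≡ i'≈i refl = trans Gx≡ (cong (λ i → u i , _) (≈⇒≡ i'≈i))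

    spoke-to-fixed : ∀ {i k l k' l'} → Fixed (u i , not l) → Spoke (toℕ i) (toℕ k) →
      G (v k , l) ≡ (v k' , l') → l' ≡ l × Spoke (toℕ i) (toℕ k')
    spoke-to-fixed fix spoke Gx≡ with image-adj-fixed fix (swap (spoke⇒adj spoke) , refl) Gx≡
    ... | adj , nl≡nl' = not-injective (sym nl≡nl') , adj⇒spoke (swap adj)

    rim-to-fixed : ∀ {k₁ k l k' l'} → Fixed (v k₁ , not l) → Rim (toℕ k) (toℕ k₁) →
      G (v k , l) ≡ (v k' , l') → l' ≡ l × Rim (toℕ k') (toℕ k₁)
    rim-to-fixed fix rim Gx≡ with image-adj-fixed fix (rim⇒adj rim , refl) Gx≡
    ... | adj , nl≡nl' = not-injective (sym nl≡nl') , adj⇒rim adj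

    spoke-from-fixed : ∀ {k i j i' j'} → Fixed (v k , not j) → Spoke (toℕ i) (toℕ k) →
      G (u i , j) ≡ (u i' , j') → j' ≡ j × Spoke (toℕ i') (toℕ k)
    spoke-from-fixed fix spoke Gx≡ with image-adj-fixed fix (spoke⇒adj spoke , refl) Gx≡
    ... | adj , nj≡nj' = not-injective (sym nj≡nj') , adj⇒spoke adj

    S₁-spoke-neighbour : parity a ≡ 1ℙ → ∀ k l → Σ (Fin n) λ i → parity (toℕ i) ≡ ⟦ not l ⟧ × Spoke (toℕ i) (toℕ k)
    S₁-spoke-neighbour a-odd k l with parity-dichotomy (parity (toℕ k)) ⟦ not l ⟧
    ... | inj₁ pk≡ = k , pk≡ , inj₁ refl
    ... | inj₂ pk≡⁻¹ = k ⊕ a , trans (parity-+odd (toℕ k) a a-odd (toℕ-mod _)) (trans (cong _⁻¹ pk≡⁻¹) (⁻¹-involutive _)) ,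
                       inj₂ (toℕ-mod _)

    hub-fixed-if-a-odd : parity a ≡ 1ℙ → ∀ k l → Fixed (v k , l)
    hub-fixed-if-a-odd a-odd k l with hub-image k l | S₁-spoke-neighbour a-odd k l
    ... | k' , l' , Gx≡ , inv | i , pi≡ , spoke with spoke-to-fixed (S₁-fixed pi≡) spoke Gx≡
    ... | refl , spoke' =
      v-fixed Gx≡ (sym (odd-spokes (toℕ k) (toℕ k') a-odd spoke spoke' (ℙₚ.+-cancelʳ-≡ _ _ _ inv))) refl

    hub-fixed-by-spokes : parity a ≡ 0ℙ → a ≢ m → ∀ {k l} → parity (toℕ k) ≡ ⟦ not l ⟧ → Fixed (v k , l)
    hub-fixed-by-spokes a-even a≢m {k} {l} pk≡ with hub-image k l
    ... | k' , l' , Gx≡ , _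
      with spoke-to-fixed (S₁-fixed pk≡) (inj₁ refl) Gx≡
         | spoke-to-fixed (S₁-fixed (trans (parity-+even (toℕ k) a a-even (toℕ-mod _)) pk≡)) (inj₂ (toℕ-mod _)) Gx≡
    ... | refl , spoke₀ | _ , spoke₁ = v-fixed Gx≡ (sym (two-spokes a≢m spoke₀ spoke₁ (toℕ-mod _))) refl

    rim-neighbour-fixed : parity a ≡ 0ℙ → a ≢ m → parity r ≡ 0ℙ →
      ∀ (k k₁ : Fin n) {l} → parity (toℕ k) ≡ ⟦ l ⟧ → Rim (toℕ k) (toℕ k₁) → Fixed (v k₁ , not l)
    rim-neighbour-fixed a-even a≢m r-even k k₁ {l} pk≡ rim =
      hub-fixed-by-spokes a-even a≢m (trans pk₁≡pk (trans pk≡ (cong ⟦_⟧ (sym (not-involutive l)))))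
      where
      pk₁≡pk : parity (toℕ k₁) ≡ parity (toℕ k)
      pk₁≡pk = [ parity-+even (toℕ k) r r-even , sym ∘ parity-+even (toℕ k₁) r r-even ] rim

    hub-fixed-by-rims : parity a ≡ 0ℙ → a ≢ m → parity r ≡ 0ℙ → r + r ≢ m →
      ∀ {k l} → parity (toℕ k) ≡ ⟦ l ⟧ → Fixed (v k , l)
    hub-fixed-by-rims a-even a≢m r-even 2r≢m {k} {l} pk≡ with hub-image k l
    ... | k' , l' , Gx≡ , _
      with rim-to-fixed (rim-neighbour-fixed a-even a≢m r-even k (k ⊕ r) pk≡ (rim-succ k)) (rim-succ k) Gx≡
         | rim-to-fixed (rim-neighbour-fixed a-even a≢m r-even k (k ⊖ r) pk≡ (rim-pred k)) (rim-pred k) Gx≡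
    ... | refl , rim₁ | _ , rim₂ = v-fixed Gx≡ (two-rims 2r≢m rim₁ rim₂ (toℕ-mod _) (sym (⊖-+ k r≤n))) refl

    module _ (¬W1 : ¬ W1-shape) (¬W5 : ¬ W5-shape) (¬bipartite : ¬ Bipartite Γ) where

      a-even⇒a≢m : parity a ≡ 0ℙ → a ≢ m
      a-even⇒a≢m a-even a≡m = ¬W1 (a≡m , subst (λ x → parity x ≡ 0ℙ) a≡m a-even)

      hub-fixed : ∀ k l → Fixed (v k , l)
      hub-fixed k l with parity-dichotomy (parity a) 0ℙ
      ... | inj₂ a-odd = hub-fixed-if-a-odd a-odd k l
      ... | inj₁ a-even with parity-dichotomy (parity r) 0ℙ
      ...   | inj₂ r-odd = ⊥-elim (¬bipartite (bipartite a-even r-odd))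
      ...   | inj₁ r-even with parity-dichotomy (parity (toℕ k)) ⟦ l ⟧
      ...     | inj₁ pk≡ = hub-fixed-by-rims a-even (a-even⇒a≢m a-even) r-even (λ 2r≡m → ¬W5 (a-even , r-even , 2r≡m)) pk≡
      ...     | inj₂ pk≡ = hub-fixed-by-spokes a-even (a-even⇒a≢m a-even) (trans pk≡ (sym (⟦not⟧ l)))

      S₂-fixed : ∀ {i j} → S₂ n (u i , j) → Fixed (u i , j)
      S₂-fixed {i} {j} s with S₂-image s
      ... | i' , j' , Gx≡ , s' with spoke-from-fixed (hub-fixed i (not j)) (inj₁ refl) Gx≡
      ... | refl , inj₁ i'≈i = u-fixed Gx≡ i'≈i refl
      ... | refl , inj₂ i'≈i+a
        with spoke-from-fixed (hub-fixed (i ⊖ a) (not j)) (inj₂ (sym (⊖-+ i a≤n))) Gx≡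
      ...   | _ , inj₂ i'≈i⊖a+a = u-fixed Gx≡ (trans i'≈i⊖a+a (⊖-+ i a≤n)) refl
      ...   | _ , inj₁ i'≈i⊖a = u-fixed Gx≡ (sym (antipodal a≤n (double≢n (a-even⇒a≢m a-even)) i'≈i+a i≈i'+a)) refl
        where
        i≈i'+a : toℕ i ≈ toℕ i' + a
        i≈i'+a = sym (trans (+-congʳ-≈ a i'≈i⊖a) (⊖-+ i a≤n))
        a-even : parity a ≡ 0ℙ
        a-even = ℙₚ.+-cancelˡ-≡ (parity (toℕ i)) _ _ (begin
          parity (toℕ i) ℙ.+ parity a     ≡⟨ +-homo-+ (toℕ i) a ⟨
          parity (toℕ i + a)              ≡⟨ ≈-parity i'≈i+a ⟨
          parity (toℕ i')                 ≡⟨ trans (S₂-parity {i'} s') (sym (S₂-parity {i} s)) ⟩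
          parity (toℕ i)                  ≡⟨ ℙₚ.+-identityʳ _ ⟨
          parity (toℕ i) ℙ.+ 0ℙ           ∎)

      g-identity : ∀ x → Fixed x
      g-identity (v k , l) = hub-fixed k l
      g-identity (u i , j) with toℕ i % 2 ≟ bit j
      ... | yes s₁ = g-fixes-S₁ _ s₁
      ... | no s₂ = S₂-fixed s₂

Iso-refl : ∀ {Γ} → Iso Γ Γ
Iso-refl {Γ} = record { bij = ↔-id (V Γ) ; pres = λ x y → ⇔-id (Adj Γ x y) }

validRW : ∀ {m a r} → 2 ≤ m → 1 ≤ a → a ≤ m → 1 ≤ r → r ≤ m → ValidRW (2 * m) a r
validRW {m} 2≤m 1≤a a≤m 1≤r r≤m = ≤-trans (n≤1+n 3) (*-monoʳ-≤ 2 2≤m) , 2m∤ 1≤a a≤m , 2m∤ 1≤r r≤m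
  where
  2m∤ : ∀ {x} → 1 ≤ x → x ≤ m → ¬ (2 * m ∣ x)
  2m∤ 1≤x x≤m = >⇒∤ {{>-nonZero 1≤x}} (≤-<-trans x≤m (m<m+n m (subst (0 <_) (sym (*-identityˡ m)) (≤-trans 1≤x x≤m))))

W1-member : ∀ {m a r} → ValidRW (2 * m) a r → a ≡ m → parity m ≡ 0ℙ → InW1 (RoseWindow (2 * m) a r)
W1-member {m} {r = r} valid refl m-even with even⇒double m m-even
... | k , refl = k , r ,
  subst (λ N → ValidRW N (2 * k) r × Iso (RoseWindow (2 * (2 * k)) (2 * k) r) (RoseWindow N (2 * k) r)) n≡4k (valid , Iso-refl)
  where
  n≡4k : 2 * (2 * k) ≡ 4 * k
  n≡4k = sym (*-assoc 2 2 k)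

W5-member : ∀ {m a r} → ValidRW (2 * m) a r → parity a ≡ 0ℙ → parity r ≡ 0ℙ → r + r ≡ m → InW5 (RoseWindow (2 * m) a r)
W5-member {a = a} {r} valid a-even r-even refl with even⇒double r r-even
... | k , refl = k , a ,
  subst (λ N → ValidRW N a (2 * k) × a % 2 ≡ 0 × Iso (RoseWindow (2 * (2 * k + 2 * k)) a (2 * k)) (RoseWindow N a (2 * k)))
        (n≡8k k) (valid , Equivalence.from (%2≡bit⇔parity≡⟦⟧ a false) a-even , Iso-refl)
  where
  n≡8k : ∀ k → 2 * (2 * k + 2 * k) ≡ 8 * k
  n≡8k = solve-∀

lemma5p3 : (m a r : ℕ) → 2 ≤ m → 1 ≤ a → a ≤ m → 1 ≤ r → r ≤ m →
    NontriviallyUnstable (RoseWindow (2 * m) a r) →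
    ¬ EdgeTransitive (DC (RoseWindow (2 * m) a r)) →
    (Σ (Aut (DC (RoseWindow (2 * m) a r))) λ σ →
        Unexpected (RoseWindow (2 * m) a r) σ ×
        ¬ MapsOnto (app σ) (S₁∪S₂ (2 * m))) →
    (Σ (Aut (DC (RoseWindow (2 * m) a r))) λ g →
        InK (2 * m) a r g × ¬ (∀ x → app g x ≡ x) ×
        (∀ x → S₁ (2 * m) x → app g x ≡ x)) →
    InW1 (RoseWindow (2 * m) a r) ⊎ InW5 (RoseWindow (2 * m) a r) ⊎ InW6 (RoseWindow (2 * m) a r)
lemma5p3 m a r 2≤m 1≤a a≤m 1≤r r≤m (_ , _ , ¬bipartite , _) _ _ (g , g∈K , g≢id , g-fixes-S₁)
  with a ≟ m ×-dec parity m ℙₚ.≟ 0ℙ | parity a ℙₚ.≟ 0ℙ ×-dec (parity r ℙₚ.≟ 0ℙ ×-dec r + r ≟ m)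
... | yes (a≡m , m-even) | _ = inj₁ (W1-member (validRW 2≤m 1≤a a≤m 1≤r r≤m) a≡m m-even)
... | no _ | yes (a-even , r-even , 2r≡m) = inj₂ (inj₁ (W5-member (validRW 2≤m 1≤a a≤m 1≤r r≤m) a-even r-even 2r≡m))
... | no ¬W1 | no ¬W5 = ⊥-elim (g≢id (RoseWindowRigidity.g-identity m a r {{>-nonZero (≤-trans 1≤a a≤m)}}
                                        a≤m r≤m g g∈K g-fixes-S₁ ¬W1 ¬W5 ¬bipartite))
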